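{- Let $G=(V,E,\omega,c)$ be a connected weighted graph and let $k$ be an integer with $3\leq k\leq |V|$. Then \[\iota^M_k(G)\ \leq\ \tilde{\iota}^M_k(G)\ <\ (k-1)\ \iota^M_k(G),\] \[\iota^m_k(G)\ \leq\ \tilde{\iota}^m_k(G)\ <\ 2\Big(1-\frac{1}{k}\Big)\ \iota^m_k(G).\]
   Context: A weighted graph $G=(V,E,\omega,c)$ is a finite simple graph with vertex weights $\omega:V\to\mathbb{Q}^+$ and edge weights $c:E\to\mathbb{Q}^+$. For $A\subseteq V$, $\omega(A)=\sum_{u\in A}\omega(u)$, $E(A,B)$ is the set of edges with one end in $A$ and the other in $B$, $c(A,B)=\sum_{e\in E(A,B)}c(e)$, and $c(A)=c(A,V\setminus A)$. $\mathcal{D}_k(V)$ is the set of $k$-subpartitions of $V$, i.e. families $\{A_1,\dots,A_k\}$ of pairwise disjoint nonempty subsets of $V$; $\mathcal{P}_k(V)\subseteq\mathcal{D}_k(V)$ is the set of $k$-partitions (those with $\bigcup_i A_i=V$). Define $\iota^m_k(G)=\min_{\{A_i\}\in\mathcal{D}_k(V)}\frac1k\sum_{i=1}^k\frac{c(A_i)}{\omega(A_i)}$, $\iota^M_k(G)=\min_{\{A_i\}\in\mathcal{D}_k(V)}\max_{i}\frac{c(A_i)}{\omega(A_i)}$, and $\tilde\iota^m_k(G)$, $\tilde\iota^M_k(G)$ by the same formulas with the minimum taken over $\mathcal{P}_k(V)$ instead. -}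

module Defs where

open import Data.Nat as ℕ using (ℕ; zero; suc)
open import Data.Fin using (Fin; zero; suc)
open import Data.Bool using (Bool; true; false; if_then_else_; _∧_; not)
open import Data.Fin.Subset using (Subset; _∈_; _∉_)
open import Data.Fin.Subset.Properties using (_∈?_)
open import Data.Rational as ℚ using (ℚ; 0ℚ; _+_; _*_; _÷_; _⊔_; _≤_; _<_)
open import Data.Rational.Properties using (_≟_)
open import Data.Product using (Σ; _×_; ∃; _,_)
open import Relation.Nullary using (¬_; yes; no; does)
open import Data.Unit using (⊤)
open import Data.Integer as ℤ using (ℤ)
open import Relation.Binary.PropositionalEquality using (_≡_; _≢_)

Σℚ : ∀ {n} → (Fin n → ℚ) → ℚ
Σℚ {zero}  f = 0ℚ
Σℚ {suc n} f = f zero + Σℚ (λ i → f (suc i))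

-- Maximum of a ℚ-valued function over Fin n (0 for n = 0; only used
-- with n = k ≥ 3 and nonnegative values).
maxℚ : ∀ {n} → (Fin n → ℚ) → ℚ
maxℚ {zero}  f = 0ℚ
maxℚ {suc n} f = f zero ⊔ maxℚ (λ i → f (suc i))

-- Division, total: p / q, returning 0 when q = 0 (never happens below,
-- since ω(A) > 0 for nonempty A and k ≥ 3).
divℚ : ℚ → ℚ → ℚ
divℚ p q with q ≟ 0ℚ
... | yes _  = 0ℚ
... | no q≢0 = _÷_ p q {{ℚ.≢-nonZero q≢0}}

-- A finite simple weighted graph on vertex set Fin n.
-- adj u v = true iff {u,v} ∈ E; c u v is the weight of edge {u,v}.
record WGraph (n : ℕ) : Set where
  field
    adj     : Fin n → Fin n → Bool
    adj-irr : ∀ u → adj u u ≡ false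
    adj-sym : ∀ u v → adj u v ≡ adj v u
    ω       : Fin n → ℚ
    ω-pos   : ∀ u → 0ℚ < ω u
    c       : Fin n → Fin n → ℚ
    c-sym   : ∀ u v → adj u v ≡ true → c u v ≡ c v u
    c-pos   : ∀ u v → adj u v ≡ true → 0ℚ < c u v

module _ {n : ℕ} (G : WGraph n) where
  open WGraph G

  data Reach (u : Fin n) : Fin n → Set where
    here : Reach u u
    step : ∀ {v w} → Reach u v → adj v w ≡ true → Reach u w

  Connected : Set
  Connected = ∀ u v → Reach u v

  [_∈_] : Fin n → Subset n → Bool
  [ u ∈ A ] = does (u ∈? A)

  ωS : Subset n → ℚ
  ωS A = Σℚ (λ u → if [ u ∈ A ] then ω u else 0ℚ)

  cut : Subset n → ℚ
  cut A = Σℚ (λ u → Σℚ (λ v →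
            if [ u ∈ A ] ∧ not [ v ∈ A ] ∧ adj u v then c u v else 0ℚ))

  ratio : Subset n → ℚ
  ratio A = divℚ (cut A) (ωS A)

record SubPartition (n k : ℕ) : Set where
  field
    part     : Fin k → Subset n
    nonempty : ∀ i → ∃ λ u → u ∈ part i
    disjoint : ∀ i j → i ≢ j → ∀ u → u ∈ part i → u ∉ part j

IsPartition : ∀ {n k} → SubPartition n k → Set
IsPartition {n} {k} P = ∀ (u : Fin n) → ∃ λ (i : Fin k) → u ∈ SubPartition.part P i

module _ {n : ℕ} (G : WGraph n) (k : ℕ) where

  objM : SubPartition n k → ℚ
  objM P = maxℚ (λ i → ratio G (SubPartition.part P i))

  objm : SubPartition n k → ℚ
  objm P = divℚ (Σℚ (λ i → ratio G (SubPartition.part P i))) (ℤ.+ k ℚ./ 1)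

IsMinOver : ∀ {n k} → (SubPartition n k → Set) → (SubPartition n k → ℚ) → ℚ → Set
IsMinOver {n} {k} Q f x =
  (∃ λ P → Q P × f P ≡ x) × (∀ P → Q P → x ≤ f P)

AllSP : ∀ {n k} → SubPartition n k → Set
AllSP _ = ⊤

module _ {n : ℕ} (G : WGraph n) (k : ℕ) where
  ιM-is : ℚ → Set
  ιM-is = IsMinOver AllSP (objM G k)

  ι~M-is : ℚ → Set
  ι~M-is = IsMinOver IsPartition (objM G k)

  ιm-is : ℚ → Set
  ιm-is = IsMinOver AllSP (objm G k)

  ι~m-is : ℚ → Set
  ι~m-is = IsMinOver IsPartition (objm G k)

-- Both minima exist since, up to having the same parts, there are finitely many
-- k-subpartitions; and ι ≤ ι~ since every partition is a subpartition.  For the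
-- strict bound take a subpartition P = {Aᵢ} attaining ι.  If P covers V it is
-- itself a partition and any factor t > 1 works.  Otherwise fill P at some j:
-- replace Aⱼ by the set W of vertices lying in no other part.  Every edge leaving
-- W enters some Aᵢ with i ≠ j, so c(W) ≤ Σᵢ c(Aᵢ) − c(Aⱼ), while ω(W) > ω(Aⱼ)
-- because W also holds an uncovered vertex.  With rᵢ = c(Aᵢ)/ω(Aᵢ), wᵢ = ω(Aᵢ),
-- the ratio of W is thus below (Σ_{i≠j} rᵢwᵢ)/wⱼ.  For the max-ratio take the
-- heaviest part j, giving ratio(W) < (k − 1) maxᵢ rᵢ.  For the mean-ratio an
-- averaging argument built on Cauchy–Schwarz yields j with
-- ratio(W) < (1 − 2/k) Σᵢ rᵢ + rⱼ, so the sum of ratios drops below 2(1 − 1/k) Σᵢ rᵢ.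
-- Connectivity makes every rᵢ positive, and k ≥ 3 makes both factors exceed 1.
module Submission where

open import Defs
open import Function using (_∘_; const)
open import Data.Nat as ℕ using (ℕ; zero; suc)
import Data.Nat
import Data.Rational
open import Data.Fin using (Fin; zero; suc; toℕ; fromℕ<; inject≤)
open import Data.Fin.Properties
  using (suc-injective; any?; all?; toℕ-injective; toℕ-fromℕ<; toℕ-inject≤; toℕ≤pred[n])
  renaming (_≟_ to _≟ᶠ_)
open import Data.Integer using (+_)
import Data.Integer as ℤ
import Data.Integer.Properties as ℤ
import Data.Nat.Properties as ℕ
open import Data.Nat.Coprimality using (1-coprimeTo) renaming (sym to coprime-sym)
open import Data.Rational as ℚ
  using (ℚ; 0ℚ; 1ℚ; _+_; _*_; _-_; -_; _≤_; _<_; _/_; positive; nonNegative; nonPositive)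
open import Data.Rational.Properties
open import Data.Rational.Solver using (module +-*-Solver)
open import Data.Product using (∃; _×_; _,_; proj₁; proj₂)
open import Data.Sum using (_⊎_; inj₁; inj₂)
open import Data.Empty using (⊥-elim)
open import Data.Unit using (tt)
open import Relation.Binary.PropositionalEquality
open import Relation.Nullary using (Dec; yes; no)
open import Relation.Nullary.Decidable
  using (dec-true; dec-false; does; decidable-stable; ¬?; _×-dec_; _→-dec_)
open import Relation.Unary using (Decidable)
open import Data.Vec using (Vec; []; _∷_; lookup; tabulate)
open import Data.List as List using (List; cartesianProductWith; concatMap; filter)
open import Data.List.Relation.Unary.Any using (here; there)
import Data.List.Relation.Unary.All as All
open import Data.List.Relation.Unary.All.Properties using (all-filter)
open import Data.List.Membership.Propositional using (lose) renaming (_∈_ to _∈ₗ_)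
open import Data.List.Membership.Propositional.Properties
  using (∈-cartesianProductWith⁺; ∈-concatMap⁺; ∈-filter⁺)
open import Relation.Binary.Bundles using (DecTotalOrder)
open import Data.Vec.Properties using (lookup∘tabulate; lookup⇒[]=; []=⇒lookup)
open import Data.Vec.Functional using (updateAt)
open import Data.Vec.Functional.Properties using (updateAt-updates; updateAt-minimal)
open import Data.Bool using (Bool; true; false; if_then_else_; _∧_; not)
open import Data.Fin.Subset using (Subset; _∈_; _∉_)
open import Data.Fin.Subset.Properties using (_∈?_)
open import Data.List.Extrema (DecTotalOrder.totalOrder ≤-decTotalOrder)
  using (argmin; argmin-all; f[argmin]≤f[xs])
open +-*-Solver

Σ-cong : ∀ {n} {f g : Fin n → ℚ} → (∀ i → f i ≡ g i) → Σℚ f ≡ Σℚ g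
Σ-cong {zero}  f≗g = refl
Σ-cong {suc n} f≗g = cong₂ _+_ (f≗g zero) (Σ-cong (f≗g ∘ suc))

Σ-zero : ∀ n → Σℚ {n} (λ _ → 0ℚ) ≡ 0ℚ
Σ-zero zero    = refl
Σ-zero (suc n) = trans (+-identityˡ _) (Σ-zero n)

Σ-+ : ∀ {n} (f g : Fin n → ℚ) → Σℚ (λ i → f i + g i) ≡ Σℚ f + Σℚ g
Σ-+ {zero}  f g = refl
Σ-+ {suc n} f g rewrite Σ-+ (f ∘ suc) (g ∘ suc) =
  solve 4 (λ a b c d → (a :+ b) :+ (c :+ d) := (a :+ c) :+ (b :+ d)) refl
    (f zero) (g zero) (Σℚ (f ∘ suc)) (Σℚ (g ∘ suc))

Σ-scale : ∀ {n} (a : ℚ) (f : Fin n → ℚ) → Σℚ (λ i → a * f i) ≡ a * Σℚ f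
Σ-scale {zero}  a f = sym (*-zeroʳ a)
Σ-scale {suc n} a f rewrite Σ-scale a (f ∘ suc) = sym (*-distribˡ-+ a (f zero) _)

Σ-neg : ∀ {n} (f : Fin n → ℚ) → Σℚ (λ i → - f i) ≡ - Σℚ f
Σ-neg {zero}  f = refl
Σ-neg {suc n} f rewrite Σ-neg (f ∘ suc) = sym (neg-distrib-+ (f zero) _)

Σ-- : ∀ {n} (f g : Fin n → ℚ) → Σℚ (λ i → f i - g i) ≡ Σℚ f - Σℚ g
Σ-- f g = trans (Σ-+ f (λ i → - g i)) (cong (λ x → Σℚ f + x) (Σ-neg g))

Σ-mono : ∀ {n} {f g : Fin n → ℚ} → (∀ i → f i ≤ g i) → Σℚ f ≤ Σℚ g
Σ-mono {zero}  f≤g = ≤-refl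
Σ-mono {suc n} f≤g = +-mono-≤ (f≤g zero) (Σ-mono (f≤g ∘ suc))

Σ-mono-< : ∀ {n} {f g : Fin n → ℚ} → (∀ i → f i ≤ g i) → ∀ j → f j < g j → Σℚ f < Σℚ g
Σ-mono-< {suc n} f≤g zero    fj<gj = +-mono-<-≤ fj<gj (Σ-mono (f≤g ∘ suc))
Σ-mono-< {suc n} f≤g (suc j) fj<gj = +-mono-≤-< (f≤g zero) (Σ-mono-< (f≤g ∘ suc) j fj<gj)

Σ-nonneg : ∀ {n} {f : Fin n → ℚ} → (∀ i → 0ℚ ≤ f i) → 0ℚ ≤ Σℚ f
Σ-nonneg {n} {f} f≥0 = subst (_≤ Σℚ f) (Σ-zero n) (Σ-mono f≥0)

Σ-term : ∀ {n} {f : Fin n → ℚ} → (∀ i → 0ℚ ≤ f i) → ∀ j → f j ≤ Σℚ f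
Σ-term {suc n} {f} f≥0 zero =
  subst (_≤ Σℚ f) (+-identityʳ (f zero)) (+-monoʳ-≤ (f zero) (Σ-nonneg (f≥0 ∘ suc)))
Σ-term {suc n} {f} f≥0 (suc j) =
  subst (_≤ Σℚ f) (+-identityˡ (f (suc j))) (+-mono-≤ (f≥0 zero) (Σ-term (f≥0 ∘ suc) j))

Σ-two-terms : ∀ {n} {f : Fin n → ℚ} → (∀ i → 0ℚ ≤ f i) → ∀ i j → i ≢ j → f i + f j ≤ Σℚ f
Σ-two-terms {suc n} {f} f≥0 zero zero i≢j = ⊥-elim (i≢j refl)
Σ-two-terms {suc n} {f} f≥0 zero (suc j) _ = +-monoʳ-≤ (f zero) (Σ-term (f≥0 ∘ suc) j)
Σ-two-terms {suc n} {f} f≥0 (suc i) zero _ =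
  subst (_≤ Σℚ f) (+-comm (f zero) (f (suc i))) (+-monoʳ-≤ (f zero) (Σ-term (f≥0 ∘ suc) i))
Σ-two-terms {suc n} {f} f≥0 (suc i) (suc j) i≢j =
  ≤-trans (Σ-two-terms (f≥0 ∘ suc) i j (i≢j ∘ cong suc))
          (subst (_≤ Σℚ f) (+-identityˡ _) (+-monoˡ-≤ (Σℚ (f ∘ suc)) (f≥0 zero)))

Σ-swap : ∀ {m n} (F : Fin m → Fin n → ℚ) →
         Σℚ (λ i → Σℚ (λ j → F i j)) ≡ Σℚ (λ j → Σℚ (λ i → F i j))
Σ-swap {zero}  {n} F = sym (Σ-zero n)
Σ-swap {suc m} {n} F =
  trans (cong (λ x → Σℚ (F zero) + x) (Σ-swap (F ∘ suc)))
        (sym (Σ-+ (F zero) (λ j → Σℚ (λ i → F (suc i) j))))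

Σ-update : ∀ {n} (f g : Fin n → ℚ) j → (∀ i → i ≢ j → g i ≡ f i) → Σℚ g + f j ≡ Σℚ f + g j
Σ-update {suc n} f g zero g≗f rewrite Σ-cong {f = g ∘ suc} {g = f ∘ suc} (λ i → g≗f (suc i) (λ ())) =
  solve 3 (λ a b c → a :+ b :+ c := c :+ b :+ a) refl (g zero) (Σℚ (f ∘ suc)) (f zero)
Σ-update {suc n} f g (suc j) g≗f rewrite g≗f zero (λ ()) = begin
  f zero + Σℚ (g ∘ suc) + f (suc j)   ≡⟨ +-assoc (f zero) _ _ ⟩
  f zero + (Σℚ (g ∘ suc) + f (suc j)) ≡⟨ cong (λ x → f zero + x) (Σ-update (f ∘ suc) (g ∘ suc) j
                                            (λ i i≢j → g≗f (suc i) (i≢j ∘ suc-injective))) ⟩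
  f zero + (Σℚ (f ∘ suc) + g (suc j)) ≡⟨ sym (+-assoc (f zero) _ _) ⟩
  f zero + Σℚ (f ∘ suc) + g (suc j)   ∎
  where open ≡-Reasoning

nq : ℕ → ℚ
nq n = + n / 1

two : ℚ
two = nq 2

nq-mkℚ : ∀ n → nq n ≡ ℚ.mkℚ (+ n) 0 (coprime-sym (1-coprimeTo n))
nq-mkℚ n = normalize-coprime (coprime-sym (1-coprimeTo n))

nq-suc : ∀ n → nq (suc n) ≡ 1ℚ + nq n
nq-suc n = sym (trans (cong (λ x → 1ℚ + x) (nq-mkℚ n))
  (/-cong (cong (λ x → + 1 ℤ.+ x) (trans (ℤ.+◃n≡+n (n ℕ.* 1)) (cong +_ (ℕ.*-identityʳ n)))) refl))

nq-mono-≤ : ∀ {m n} → m ℕ.≤ n → nq m ≤ nq n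
nq-mono-≤ {m} {n} m≤n rewrite nq-mkℚ m | nq-mkℚ n =
  ℚ.*≤* (subst₂ ℤ._≤_ (sym (ℤ.*-identityʳ (+ m))) (sym (ℤ.*-identityʳ (+ n))) (ℤ.+≤+ m≤n))

nq-mono-< : ∀ {m n} → m ℕ.< n → nq m < nq n
nq-mono-< {m} {n} m<n rewrite nq-mkℚ m | nq-mkℚ n =
  ℚ.*<* (subst₂ ℤ._<_ (sym (ℤ.*-identityʳ (+ m))) (sym (ℤ.*-identityʳ (+ n))) (ℤ.+<+ m<n))

Σ-const : ∀ n (a : ℚ) → Σℚ {n} (λ _ → a) ≡ nq n * a
Σ-const zero    a = sym (*-zeroˡ a)
Σ-const (suc n) a rewrite Σ-const n a | nq-suc n =
  solve 2 (λ a x → a :+ x :* a := (con 1ℚ :+ x) :* a) refl a (nq n)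

*-nonneg : ∀ {a b} → 0ℚ ≤ a → 0ℚ ≤ b → 0ℚ ≤ a * b
*-nonneg {a} {b} a≥0 b≥0 =
  nonNegative⁻¹ (a * b) {{nonNeg*nonNeg⇒nonNeg a {{nonNegative a≥0}} b {{nonNegative b≥0}}}}

*-pos : ∀ {a b} → 0ℚ < a → 0ℚ < b → 0ℚ < a * b
*-pos {a} {b} a>0 b>0 = positive⁻¹ (a * b) {{pos*pos⇒pos a {{positive a>0}} b {{positive b>0}}}}

square-nonneg : ∀ x → 0ℚ ≤ x * x
square-nonneg x with ≤-total 0ℚ x
... | inj₁ x≥0 = *-nonneg x≥0 x≥0
... | inj₂ x≤0 = nonNegative⁻¹ (x * x)
                   {{nonPos*nonPos⇒nonPos x {{nonPositive x≤0}} x {{nonPositive x≤0}}}}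

+-nonneg : ∀ {a b} → 0ℚ ≤ a → 0ℚ ≤ b → 0ℚ ≤ a + b
+-nonneg {a} {b} a≥0 b≥0 = subst (_≤ a + b) (+-identityˡ 0ℚ) (+-mono-≤ a≥0 b≥0)

≤⇒diff-nonneg : ∀ {a b} → a ≤ b → 0ℚ ≤ b - a
≤⇒diff-nonneg {a} {b} a≤b = subst (_≤ b - a) (+-inverseʳ a) (+-monoˡ-≤ (- a) a≤b)

diff-nonneg⇒≤ : ∀ {a b} → 0ℚ ≤ b - a → a ≤ b
diff-nonneg⇒≤ {a} {b} d≥0 =
  subst₂ _≤_ (+-identityˡ a) (solve 2 (λ a b → b :- a :+ a := b) refl a b) (+-monoˡ-≤ a d≥0)

<⇒diff-pos : ∀ {a b} → a < b → 0ℚ < b - a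
<⇒diff-pos {a} {b} a<b = subst (_< b - a) (+-inverseʳ a) (+-monoˡ-< (- a) a<b)

≤-sub : ∀ {a b s} → a + b ≤ s → a ≤ s - b
≤-sub {a} {b} {s} a+b≤s =
  subst (_≤ s - b) (solve 2 (λ a b → a :+ b :- b := a) refl a b) (+-monoˡ-≤ (- b) a+b≤s)

divℚ-* : ∀ p q → 0ℚ < q → divℚ p q * q ≡ p
divℚ-* p q q>0 with q ≟ 0ℚ
... | yes q≡0 = ⊥-elim (<-irrefl (sym q≡0) q>0)
... | no  q≢0 = trans (*-assoc p (ℚ.1/ q) q) (trans (cong (p *_) (*-inverseˡ q)) (*-identityʳ p))
  where instance _ = ℚ.≢-nonZero q≢0

divℚ-pos : ∀ {p q} → 0ℚ < p → 0ℚ < q → 0ℚ < divℚ p q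
divℚ-pos {p} {q} p>0 q>0 =
  *-cancelʳ-<-nonNeg q {{nonNegative (<⇒≤ q>0)}} (subst₂ _<_ (sym (*-zeroˡ q)) (sym (divℚ-* p q q>0)) p>0)

divℚ-< : ∀ {p q x} → 0ℚ < q → p < x * q → divℚ p q < x
divℚ-< {p} {q} {x} q>0 p<xq =
  *-cancelʳ-<-nonNeg q {{nonNegative (<⇒≤ q>0)}} (subst (_< x * q) (sym (divℚ-* p q q>0)) p<xq)

divℚ-scale-< : ∀ {p s q x} → 0ℚ < q → p < x * s → divℚ p q < x * divℚ s q
divℚ-scale-< {p} {s} {q} {x} q>0 p<xs = divℚ-< q>0 (subst (p <_) rescale p<xs)
  where
  rescale : x * s ≡ x * divℚ s q * q
  rescale = trans (cong (x *_) (sym (divℚ-* s q q>0))) (sym (*-assoc x (divℚ s q) q))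

ratio-< : ∀ {p q z w} → 0ℚ < z → 0ℚ < w → p ≤ z * w → w < q → divℚ p q < z
ratio-< {p} {q} {z} {w} z>0 w>0 p≤zw w<q =
  divℚ-< (<-trans w>0 w<q) (≤-<-trans p≤zw (*-monoʳ-<-pos z {{positive z>0}} w<q))

maxℚ-ub : ∀ {n} (f : Fin n → ℚ) i → f i ≤ maxℚ f
maxℚ-ub f zero    = p≤p⊔q (f zero) _
maxℚ-ub f (suc i) = p≤q⇒p≤r⊔q (f zero) (maxℚ-ub (f ∘ suc) i)

maxℚ-< : ∀ {n} {f : Fin n → ℚ} {B} → 0ℚ < B → (∀ i → f i < B) → maxℚ f < B
maxℚ-< {zero}          B>0 f<B = B>0
maxℚ-< {suc n} {f} {B} B>0 f<B with ⊔-sel (f zero) (maxℚ (f ∘ suc))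
... | inj₁ eq = subst (_< B) (sym eq) (f<B zero)
... | inj₂ eq = subst (_< B) (sym eq) (maxℚ-< B>0 (f<B ∘ suc))

argmax : ∀ {n} (f : Fin (suc n) → ℚ) → ∃ λ j → ∀ i → f i ≤ f j
argmax {zero} f = zero , λ { zero → ≤-refl }
argmax {suc n} f with argmax (f ∘ suc)
... | j , f≤fj with ≤-total (f zero) (f (suc j))
...   | inj₁ f0≤ = suc j , λ { zero → f0≤ ; (suc i) → f≤fj i }
...   | inj₂ f0≥ = zero  , λ { zero → ≤-refl ; (suc i) → ≤-trans (f≤fj i) f0≥ }

ΣΣ : ∀ {k} → (Fin k → Fin k → ℚ) → ℚ
ΣΣ F = Σℚ (λ i → Σℚ (F i))

ΣΣ-- : ∀ {k} (F G : Fin k → Fin k → ℚ) → ΣΣ (λ i j → F i j - G i j) ≡ ΣΣ F - ΣΣ G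
ΣΣ-- F G = trans (Σ-cong (λ i → Σ-- (F i) (G i))) (Σ-- (λ i → Σℚ (F i)) (λ i → Σℚ (G i)))

ΣΣ-product : ∀ {k} (a b : Fin k → ℚ) → ΣΣ (λ i j → a i * b j) ≡ Σℚ a * Σℚ b
ΣΣ-product a b = begin
  Σℚ (λ i → Σℚ (λ j → a i * b j)) ≡⟨ Σ-cong (λ i → Σ-scale (a i) b) ⟩
  Σℚ (λ i → a i * Σℚ b)           ≡⟨ Σ-cong (λ i → *-comm (a i) (Σℚ b)) ⟩
  Σℚ (λ i → Σℚ b * a i)           ≡⟨ Σ-scale (Σℚ b) a ⟩
  Σℚ b * Σℚ a                     ≡⟨ *-comm (Σℚ b) (Σℚ a) ⟩
  Σℚ a * Σℚ b                     ∎
  where open ≡-Reasoning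

ΣΣ-nonneg : ∀ {k} (F : Fin k → Fin k → ℚ) → (∀ i j → 0ℚ ≤ F i j + F j i) → 0ℚ ≤ ΣΣ F
ΣΣ-nonneg F pairs≥0 = half-nonneg (subst (0ℚ ≤_) symmetrised (Σ-nonneg (λ i → Σ-nonneg (pairs≥0 i))))
  where
  symmetrised : ΣΣ (λ i j → F i j + F j i) ≡ ΣΣ F + ΣΣ F
  symmetrised = trans (Σ-cong (λ i → Σ-+ (F i) (λ j → F j i)))
    (trans (Σ-+ (λ i → Σℚ (F i)) (λ i → Σℚ (λ j → F j i)))
           (cong (λ x → ΣΣ F + x) (Σ-swap (λ i j → F j i))))
  half-nonneg : ∀ {x} → 0ℚ ≤ x + x → 0ℚ ≤ x
  half-nonneg {x} 2x≥0 with ≤-total 0ℚ x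
  ... | inj₁ x≥0 = x≥0
  ... | inj₂ x≤0 = ≤-trans 2x≥0 (subst (x + x ≤_) (+-identityʳ x) (+-monoʳ-≤ x x≤0))

-- (Σ pᵢxᵢ)² ≤ (Σ pᵢ)(Σ pᵢxᵢ²) for nonnegative weights p: the double sum of
-- pᵢpⱼ(xᵢ − xⱼ)² equals twice the difference of the two sides.
cauchy-schwarz : ∀ {k} (p x : Fin k → ℚ) → (∀ i → 0ℚ ≤ p i) →
  Σℚ (λ i → p i * x i) * Σℚ (λ i → p i * x i) ≤ Σℚ p * Σℚ (λ i → p i * x i * x i)
cauchy-schwarz {k} p x p≥0 = diff-nonneg⇒≤ (subst (0ℚ ≤_) double-sum (ΣΣ-nonneg F symmetric-pair))
  where
  F : Fin k → Fin k → ℚ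
  F i j = p i * (p j * x j * x j) - (p i * x i) * (p j * x j)
  double-sum : ΣΣ F ≡ Σℚ p * Σℚ (λ i → p i * x i * x i)
                    - Σℚ (λ i → p i * x i) * Σℚ (λ i → p i * x i)
  double-sum = trans (ΣΣ-- (λ i j → p i * (p j * x j * x j)) (λ i j → (p i * x i) * (p j * x j)))
                     (cong₂ _-_ (ΣΣ-product p (λ j → p j * x j * x j))
                                (ΣΣ-product (λ i → p i * x i) (λ j → p j * x j)))
  symmetric-pair : ∀ i j → 0ℚ ≤ F i j + F j i
  symmetric-pair i j = subst (0ℚ ≤_)
    (solve 4 (λ a b x y → a :* b :* ((x :- y) :* (x :- y)) :=
       (a :* (b :* y :* y) :- (a :* x) :* (b :* y)) :+ (b :* (a :* x :* x) :- (b :* y) :* (a :* x)))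
       refl (p i) (p j) (x i) (x j))
    (*-nonneg (*-nonneg (p≥0 i) (p≥0 j)) (square-nonneg (x i - x j)))

cauchy-schwarz-1 : ∀ {k} (c : Fin k → ℚ) → Σℚ c * Σℚ c ≤ nq k * Σℚ (λ i → c i * c i)
cauchy-schwarz-1 {k} c = subst₂ _≤_ (cong₂ _*_ Σ1c Σ1c) (cong₂ _*_ Σ1 Σ1cc)
                           (cauchy-schwarz (λ _ → 1ℚ) c (λ _ → nonNegative⁻¹ 1ℚ))
  where
  Σ1c  = Σ-cong (λ i → *-identityˡ (c i))
  Σ1cc = Σ-cong (λ i → cong (_* c i) (*-identityˡ (c i)))
  Σ1   = trans (Σ-const k 1ℚ) (*-identityʳ (nq k))

nonneg-term : ∀ {k} (p e : Fin (suc k) → ℚ) → (∀ j → 0ℚ < p j) →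
              0ℚ ≤ Σℚ (λ j → p j * e j) → ∃ λ j → 0ℚ ≤ e j
nonneg-term {k} p e p>0 sum≥0 with any? (λ j → 0ℚ ≤? e j)
... | yes found = found
... | no  none  = ⊥-elim (<-irrefl refl (<-≤-trans sum<0 sum≥0))
  where
  term<0 : ∀ j → p j * e j < 0ℚ
  term<0 j = subst (p j * e j <_) (*-zeroʳ (p j))
               (*-monoʳ-<-pos (p j) {{positive (p>0 j)}} (≰⇒> (λ ej≥0 → none (j , ej≥0))))
  sum<0 : Σℚ (λ j → p j * e j) < 0ℚ
  sum<0 = subst (Σℚ (λ j → p j * e j) <_) (Σ-zero (suc k)) (Σ-mono-< (<⇒≤ ∘ term<0) zero (term<0 zero))

Σ-others-≤ : ∀ {k} (f : Fin (suc k) → ℚ) M → (∀ i → f i ≤ M) → ∀ j → Σℚ f - f j ≤ nq k * M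
Σ-others-≤ {k} f M f≤M j = diff-nonneg⇒≤ (subst (0ℚ ≤_) rearranged (≤⇒diff-nonneg gap≤gaps))
  where
  gap≤gaps : M - f j ≤ Σℚ (λ i → M - f i)
  gap≤gaps = Σ-term (λ i → ≤⇒diff-nonneg (f≤M i)) j
  rearranged : Σℚ (λ i → M - f i) - (M - f j) ≡ nq k * M - (Σℚ f - f j)
  rearranged = begin
    Σℚ (λ i → M - f i) - (M - f j)           ≡⟨ cong (_- (M - f j)) (Σ-- (λ _ → M) f) ⟩
    Σℚ {suc k} (λ _ → M) - Σℚ f - (M - f j)  ≡⟨ cong (λ x → x - Σℚ f - (M - f j))
                                                   (trans (Σ-const (suc k) M) (cong (_* M) (nq-suc k))) ⟩
    (1ℚ + nq k) * M - Σℚ f - (M - f j)       ≡⟨ solve 4 (λ n m s r → (con 1ℚ :+ n) :* m :- s :- (m :- r)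
                                                                 := n :* m :- (s :- r))
                                                   refl (nq k) M (Σℚ f) (f j) ⟩
    nq k * M - (Σℚ f - f j)                  ∎
    where open ≡-Reasoning

averaging-identity : ∀ ι K S Q Z C → ι * K ≡ 1ℚ →
  (1ℚ - two * ι) * S * Q + two * Z - C * C
    ≡ (1ℚ - two * ι) * (S * Q - C * C) + (two * ι) * (K * Z - C * C)
averaging-identity ι K S Q Z C ιK≡1 = begin
  λ′ * S * Q + two * Z - C * C
    ≡⟨ solve 7 (λ i kk s q z cc t → (con 1ℚ :- t :* i) :* s :* q :+ t :* z :- cc :* cc
         := (con 1ℚ :- t :* i) :* (s :* q :- cc :* cc) :+ (t :* i) :* (kk :* z :- cc :* cc)
            :+ t :* (con 1ℚ :- i :* kk) :* z)
         refl ι K S Q Z C two ⟩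
  rhs + two * (1ℚ - ι * K) * Z ≡⟨ cong (λ u → rhs + two * (1ℚ - u) * Z) ιK≡1 ⟩
  rhs + two * (1ℚ - 1ℚ) * Z    ≡⟨ solve 3 (λ a t z → a :+ t :* (con 1ℚ :- con 1ℚ) :* z := a) refl rhs two Z ⟩
  rhs                          ∎
  where
  open ≡-Reasoning
  λ′ = 1ℚ - two * ι
  rhs = λ′ * (S * Q - C * C) + (two * ι) * (K * Z - C * C)

module Choice {k : ℕ} (r w : Fin (suc k) → ℚ) (r>0 : ∀ i → 0ℚ < r i) (w>0 : ∀ i → 0ℚ < w i) where

  c : Fin (suc k) → ℚ
  c i = r i * w i

  S C : ℚ
  S = Σℚ r
  C = Σℚ c

  max-choice : ∀ j → (∀ i → w i ≤ w j) → ∀ M → (∀ i → r i ≤ M) → C - c j ≤ (nq k * M) * w j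
  max-choice j w≤wj M r≤M =
    subst (C - c j ≤_) (sym (*-assoc (nq k) M (w j))) (Σ-others-≤ c (M * w j) c≤Mwj j)
    where
    c≤Mwj : ∀ i → c i ≤ M * w j
    c≤Mwj i = ≤-trans (*-monoʳ-≤-nonNeg (w i) {{nonNegative (<⇒≤ (w>0 i))}} (r≤M i))
                      (*-monoˡ-≤-nonNeg M {{nonNegative (≤-trans (<⇒≤ (r>0 i)) (r≤M i))}} (w≤wj i))

  -- Averaging: for λ = 1 − 2/k ≥ 0 some j has C − cⱼ ≤ (λS + rⱼ) wⱼ.  The
  -- cⱼ-weighted sum of the slacks is λ(S·Σrw² − C²) + (2/k)(k·Σc² − C²) ≥ 0.
  mean-choice : ∀ ι → 0ℚ ≤ ι → ι * nq (suc k) ≡ 1ℚ → 0ℚ ≤ 1ℚ - two * ι →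
                ∃ λ j → C - c j ≤ ((1ℚ - two * ι) * S + r j) * w j
  mean-choice ι ι≥0 ιk≡1 λ≥0 = let (j , slack≥0) = nonneg-term c slack c>0 weighted≥0
                               in j , diff-nonneg⇒≤ slack≥0
    where
    λ′ = 1ℚ - two * ι
    slack : Fin (suc k) → ℚ
    slack j = (λ′ * S + r j) * w j - (C - c j)
    Q Z : ℚ
    Q = Σℚ (λ j → r j * w j * w j)
    Z = Σℚ (λ j → c j * c j)
    c>0 : ∀ j → 0ℚ < c j
    c>0 j = *-pos (r>0 j) (w>0 j)
    weighted-sum : Σℚ (λ j → c j * slack j) ≡ λ′ * S * Q + two * Z - C * C
    weighted-sum = begin
      Σℚ (λ j → c j * slack j)
        ≡⟨ Σ-cong (λ j → solve 5 (λ r w l s cc → r :* w :* ((l :* s :+ r) :* w :- (cc :- r :* w))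
             := (l :* s) :* (r :* w :* w) :+ (con 1ℚ :+ con 1ℚ) :* ((r :* w) :* (r :* w)) :- cc :* (r :* w))
             refl (r j) (w j) λ′ S C) ⟩
      Σℚ (λ j → (λ′ * S) * (r j * w j * w j) + two * (c j * c j) - C * c j)
        ≡⟨ Σ-- (λ j → (λ′ * S) * (r j * w j * w j) + two * (c j * c j)) (λ j → C * c j) ⟩
      Σℚ (λ j → (λ′ * S) * (r j * w j * w j) + two * (c j * c j)) - Σℚ (λ j → C * c j)
        ≡⟨ cong₂ _-_ (trans (Σ-+ (λ j → (λ′ * S) * (r j * w j * w j)) (λ j → two * (c j * c j)))
                            (cong₂ _+_ (Σ-scale (λ′ * S) (λ j → r j * w j * w j)) (Σ-scale two (λ j → c j * c j))))
                     (Σ-scale C c) ⟩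
      λ′ * S * Q + two * Z - C * C ∎
      where open ≡-Reasoning
    weighted≥0 : 0ℚ ≤ Σℚ (λ j → c j * slack j)
    weighted≥0 = subst (0ℚ ≤_) (sym (trans weighted-sum (averaging-identity ι (nq (suc k)) S Q Z C ιk≡1)))
      (+-nonneg (*-nonneg λ≥0 (≤⇒diff-nonneg (cauchy-schwarz r w (<⇒≤ ∘ r>0))))
                (*-nonneg (*-nonneg (nonNegative⁻¹ two) ι≥0) (≤⇒diff-nonneg (cauchy-schwarz-1 c))))

module GraphFacts {n : ℕ} (G : WGraph n) where
  open WGraph G

  ωTerm : Subset n → Fin n → ℚ
  ωTerm A u = if [_∈_] G u A then ω u else 0ℚ

  cutTerm : Subset n → Fin n → Fin n → ℚ
  cutTerm A u v = if [_∈_] G u A ∧ not ([_∈_] G v A) ∧ adj u v then c u v else 0ℚ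

  ωTerm-∈ : ∀ {A u} → u ∈ A → ωTerm A u ≡ ω u
  ωTerm-∈ {A} {u} u∈A rewrite dec-true (u ∈? A) u∈A = refl

  ωTerm-∉ : ∀ {A u} → u ∉ A → ωTerm A u ≡ 0ℚ
  ωTerm-∉ {A} {u} u∉A rewrite dec-false (u ∈? A) u∉A = refl

  ωTerm-nonneg : ∀ A u → 0ℚ ≤ ωTerm A u
  ωTerm-nonneg A u with u ∈? A
  ... | yes _ = <⇒≤ (ω-pos u)
  ... | no  _ = ≤-refl

  cutTerm-edge : ∀ {A u v} → u ∈ A → v ∉ A → adj u v ≡ true → cutTerm A u v ≡ c u v
  cutTerm-edge {A} {u} {v} u∈A v∉A uv rewrite dec-true (u ∈? A) u∈A | dec-false (v ∈? A) v∉A | uv = refl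

  cutTerm-cases : ∀ A u v → cutTerm A u v ≡ 0ℚ ⊎ (u ∈ A × v ∉ A × adj u v ≡ true)
  cutTerm-cases A u v with u ∈? A | v ∈? A | adj u v
  ... | yes u∈A | no v∉A | true  = inj₂ (u∈A , v∉A , refl)
  ... | yes _   | no _   | false = inj₁ refl
  ... | yes _   | yes _  | _     = inj₁ refl
  ... | no _    | _      | _     = inj₁ refl

  cutTerm-nonneg : ∀ A u v → 0ℚ ≤ cutTerm A u v
  cutTerm-nonneg A u v with cutTerm-cases A u v
  ... | inj₁ zero≡ = ≤-reflexive (sym zero≡)
  ... | inj₂ (u∈A , v∉A , uv) = subst (0ℚ ≤_) (sym (cutTerm-edge u∈A v∉A uv)) (<⇒≤ (c-pos u v uv))

  ωS-pos : ∀ A → (∃ λ u → u ∈ A) → 0ℚ < ωS G A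
  ωS-pos A (u , u∈A) = <-≤-trans (subst (0ℚ <_) (sym (ωTerm-∈ u∈A)) (ω-pos u)) (Σ-term (ωTerm-nonneg A) u)

  ωS-< : ∀ {A B r} → (∀ u → u ∈ A → u ∈ B) → r ∈ B → r ∉ A → ωS G A < ωS G B
  ωS-< {A} {B} {r} A⊆B r∈B r∉A =
    Σ-mono-< pointwise r (subst₂ _<_ (sym (ωTerm-∉ r∉A)) (sym (ωTerm-∈ r∈B)) (ω-pos r))
    where
    pointwise : ∀ u → ωTerm A u ≤ ωTerm B u
    pointwise u with u ∈? A
    ... | yes u∈A = ≤-reflexive (sym (ωTerm-∈ (A⊆B u u∈A)))
    ... | no  _   = ωTerm-nonneg B u

  boundary-edge : ∀ {A u v} → Reach G u v → u ∈ A → v ∉ A →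
                  ∃ λ x → ∃ λ y → x ∈ A × y ∉ A × adj x y ≡ true
  boundary-edge here                u∈A v∉A = ⊥-elim (v∉A u∈A)
  boundary-edge {A} (step {w} p wv) u∈A v∉A with w ∈? A
  ... | yes w∈A = w , _ , w∈A , v∉A , wv
  ... | no  w∉A = boundary-edge p u∈A w∉A

  cut-pos : Connected G → ∀ {A u v} → u ∈ A → v ∉ A → 0ℚ < cut G A
  cut-pos connected {A} {u} {v} u∈A v∉A with boundary-edge (connected u v) u∈A v∉A
  ... | x , y , x∈A , y∉A , xy = <-≤-trans (subst (0ℚ <_) (sym (cutTerm-edge x∈A y∉A xy)) (c-pos x y xy))
    (≤-trans (Σ-term (cutTerm-nonneg A x) y) (Σ-term (λ x → Σ-nonneg (cutTerm-nonneg A x)) x))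

  -- Let W meet no Aᵢ with i ≠ j, and let every vertex outside W lie in such an Aᵢ.
  -- Each edge leaving W then enters some Aᵢ (i ≠ j) and is counted in c(Aᵢ), so
  -- c(W) ≤ Σᵢ c(Aᵢ) − c(Aⱼ).
  cut-≤-others : ∀ {k} (A : Fin k → Subset n) j W →
    (∀ i → i ≢ j → ∀ u → u ∈ W → u ∉ A i) → (∀ v → v ∉ W → ∃ λ i → i ≢ j × v ∈ A i) →
    cut G W ≤ Σℚ (λ i → cut G (A i)) - cut G (A j)
  cut-≤-others A j W W∩Aᵢ≡∅ outside-W = subst (cut G W ≤_) regroup (Σ-mono (λ u → Σ-mono (edge-bound u)))
    where
    h : _ → Fin n → Fin n → ℚ
    h i v u = cutTerm (A i) v u
    edge-bound : ∀ u v → cutTerm W u v ≤ Σℚ (λ i → h i v u) - h j v u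
    edge-bound u v with cutTerm-cases W u v
    ... | inj₁ zero≡ = subst (_≤ _) (sym zero≡) (≤⇒diff-nonneg (Σ-term (λ i → cutTerm-nonneg (A i) v u) j))
    ... | inj₂ (u∈W , v∉W , uv) with outside-W v v∉W
    ...   | i , i≢j , v∈Aᵢ = subst (_≤ _) (sym counted)
            (≤-sub (Σ-two-terms (λ i → cutTerm-nonneg (A i) v u) i j i≢j))
      where
      counted : cutTerm W u v ≡ h i v u
      counted = trans (cutTerm-edge u∈W v∉W uv) (trans (c-sym u v uv)
        (sym (cutTerm-edge v∈Aᵢ (W∩Aᵢ≡∅ i i≢j u u∈W) (trans (adj-sym v u) uv))))
    regroup : Σℚ (λ u → Σℚ (λ v → Σℚ (λ i → h i v u) - h j v u))
            ≡ Σℚ (λ i → cut G (A i)) - cut G (A j)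
    regroup = begin
      Σℚ (λ u → Σℚ (λ v → Σℚ (λ i → h i v u) - h j v u))
        ≡⟨ Σ-cong (λ u → Σ-- (λ v → Σℚ (λ i → h i v u)) (λ v → h j v u)) ⟩
      Σℚ (λ u → Σℚ (λ v → Σℚ (λ i → h i v u)) - Σℚ (λ v → h j v u))
        ≡⟨ Σ-- (λ u → Σℚ (λ v → Σℚ (λ i → h i v u))) (λ u → Σℚ (λ v → h j v u)) ⟩
      Σℚ (λ u → Σℚ (λ v → Σℚ (λ i → h i v u))) - Σℚ (λ u → Σℚ (λ v → h j v u))
        ≡⟨ cong₂ _-_ (trans (Σ-cong (λ u → Σ-swap (λ v i → h i v u)))
                     (trans (Σ-swap (λ u i → Σℚ (λ v → h i v u)))
                            (Σ-cong (λ i → Σ-swap (λ u v → h i v u)))))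
                     (Σ-swap (λ u v → h j v u)) ⟩
      Σℚ (λ i → cut G (A i)) - cut G (A j) ∎
      where open ≡-Reasoning

subsetOf : ∀ {n} {P : Fin n → Set} → Decidable P → Subset n
subsetOf P? = tabulate (does ∘ P?)

∈-subsetOf⁺ : ∀ {n} {P : Fin n → Set} (P? : Decidable P) {u} → P u → u ∈ subsetOf P?
∈-subsetOf⁺ P? {u} Pu = lookup⇒[]= u _ (trans (lookup∘tabulate (does ∘ P?) u) (dec-true (P? u) Pu))

∈-subsetOf⁻ : ∀ {n} {P : Fin n → Set} (P? : Decidable P) {u} → u ∈ subsetOf P? → P u
∈-subsetOf⁻ P? {u} u∈ =
  decidable-stable (P? u) λ ¬Pu → true≢false (trans (sym tested) (dec-false (P? u) ¬Pu))
  where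
  tested : does (P? u) ≡ true
  tested = trans (sym (lookup∘tabulate (does ∘ P?) u)) ([]=⇒lookup u∈)
  true≢false : true ≢ false
  true≢false ()

module Filling {n k : ℕ} (P : SubPartition n k) (j : Fin k) where
  open SubPartition P

  ClaimedElsewhere : Fin n → Set
  ClaimedElsewhere u = ∃ λ i → i ≢ j × u ∈ part i

  claimedElsewhere? : Decidable ClaimedElsewhere
  claimedElsewhere? u = any? (λ i → ¬? (i ≟ᶠ j) ×-dec (u ∈? part i))

  W : Subset n
  W = subsetOf (¬? ∘ claimedElsewhere?)

  W-disjoint : ∀ i → i ≢ j → ∀ u → u ∈ W → u ∉ part i
  W-disjoint i i≢j u u∈W u∈Aᵢ = ∈-subsetOf⁻ (¬? ∘ claimedElsewhere?) u∈W (i , i≢j , u∈Aᵢ)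

  outside-W : ∀ v → v ∉ W → ClaimedElsewhere v
  outside-W v v∉W = decidable-stable (claimedElsewhere? v) (v∉W ∘ ∈-subsetOf⁺ (¬? ∘ claimedElsewhere?))

  Aⱼ⊆W : ∀ u → u ∈ part j → u ∈ W
  Aⱼ⊆W u u∈Aⱼ = ∈-subsetOf⁺ (¬? ∘ claimedElsewhere?)
                  λ (i , i≢j , u∈Aᵢ) → disjoint j i (i≢j ∘ sym) u u∈Aⱼ u∈Aᵢ

  uncovered∈W : ∀ {r} → (∀ i → r ∉ part i) → r ∈ W
  uncovered∈W r∉P = ∈-subsetOf⁺ (¬? ∘ claimedElsewhere?) λ (i , _ , r∈Aᵢ) → r∉P i r∈Aᵢ

  filled : Fin k → Subset n
  filled = updateAt part j (const W)

  filled-cases : ∀ i → (i ≡ j × filled i ≡ W) ⊎ (i ≢ j × filled i ≡ part i)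
  filled-cases i with i ≟ᶠ j
  ... | yes refl = inj₁ (refl , updateAt-updates j part)
  ... | no  i≢j  = inj₂ (i≢j , updateAt-minimal i j part i≢j)

  fill : SubPartition n k
  fill = record { part = filled ; nonempty = nonempty′ ; disjoint = disjoint′ }
    where
    nonempty′ : ∀ i → ∃ λ u → u ∈ filled i
    nonempty′ i with filled-cases i
    ... | inj₁ (refl , eq) = let (u , u∈Aⱼ) = nonempty j in u , subst (u ∈_) (sym eq) (Aⱼ⊆W u u∈Aⱼ)
    ... | inj₂ (_ , eq)    = let (u , u∈Aᵢ) = nonempty i in u , subst (u ∈_) (sym eq) u∈Aᵢ
    disjoint′ : ∀ i i′ → i ≢ i′ → ∀ u → u ∈ filled i → u ∉ filled i′
    disjoint′ i i′ i≢i′ u with filled-cases i | filled-cases i′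
    ... | inj₁ (refl , _)    | inj₁ (refl , _)     = ⊥-elim (i≢i′ refl)
    ... | inj₁ (refl , eq)   | inj₂ (i′≢j , eq′)  = λ u∈ u∈′ →
          W-disjoint i′ i′≢j u (subst (u ∈_) eq u∈) (subst (u ∈_) eq′ u∈′)
    ... | inj₂ (i≢j , eq)    | inj₁ (refl , eq′)   = λ u∈ u∈′ →
          W-disjoint i i≢j u (subst (u ∈_) eq′ u∈′) (subst (u ∈_) eq u∈)
    ... | inj₂ (_ , eq)      | inj₂ (_ , eq′)      = λ u∈ u∈′ →
          disjoint i i′ i≢i′ u (subst (u ∈_) eq u∈) (subst (u ∈_) eq′ u∈′)

  fill-isPartition : IsPartition fill
  fill-isPartition u with u ∈? W
  ... | yes u∈W = j , subst (u ∈_) (sym (updateAt-updates j part)) u∈W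
  ... | no  u∉W = let (i , i≢j , u∈Aᵢ) = outside-W u u∉W
                  in i , subst (u ∈_) (sym (updateAt-minimal i j part i≢j)) u∈Aᵢ

  cut-W : (G : WGraph n) → cut G W ≤ Σℚ (λ i → cut G (part i)) - cut G (part j)
  cut-W G = GraphFacts.cut-≤-others G part j W W-disjoint outside-W

  ω-W : (G : WGraph n) → ∀ {r} → (∀ i → r ∉ part i) → ωS G (part j) < ωS G W
  ω-W G r∉P = GraphFacts.ωS-< G Aⱼ⊆W (uncovered∈W r∉P) (r∉P j)

module Reciprocal (k : ℕ) where

  ι : ℚ
  ι = divℚ 1ℚ (nq k)

  module _ (k>0 : 0 ℕ.< k) where
    private
      K>0 : 0ℚ < nq k
      K>0 = nq-mono-< k>0

    ι*k≡1 : ι * nq k ≡ 1ℚ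
    ι*k≡1 = divℚ-* 1ℚ (nq k) K>0

    ι≥0 : 0ℚ ≤ ι
    ι≥0 = <⇒≤ (divℚ-pos (positive⁻¹ 1ℚ) K>0)

    -- 2ι · k = 2, so comparing 2ι with 1 is comparing 2 with k.
    2ι*k≡2 : two * ι * nq k ≡ two
    2ι*k≡2 = trans (*-assoc two ι (nq k)) (trans (cong (two *_) ι*k≡1) (*-identityʳ two))

    2ι≤1 : 2 ℕ.≤ k → two * ι ≤ 1ℚ
    2ι≤1 2≤k = *-cancelʳ-≤-pos (nq k) {{positive K>0}}
                 (subst₂ _≤_ (sym 2ι*k≡2) (sym (*-identityˡ (nq k))) (nq-mono-≤ 2≤k))

    2ι<1 : 2 ℕ.< k → two * ι < 1ℚ
    2ι<1 2<k = *-cancelʳ-<-nonNeg (nq k) {{nonNegative (<⇒≤ K>0)}}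
                 (subst₂ _<_ (sym 2ι*k≡2) (sym (*-identityˡ (nq k))) (nq-mono-< 2<k))

    1<2[1-ι] : 2 ℕ.< k → 1ℚ < two * (1ℚ - ι)
    1<2[1-ι] 2<k = subst₂ _<_ (+-identityʳ 1ℚ)
      (solve 1 (λ i → con 1ℚ :+ (con 1ℚ :- (con 1ℚ :+ con 1ℚ) :* i)
                   := (con 1ℚ :+ con 1ℚ) :* (con 1ℚ :- i)) refl ι)
      (+-monoʳ-< 1ℚ (<⇒diff-pos (2ι<1 2<k)))

module Improvement {n m : ℕ} (G : WGraph n) (connected : Connected G)
                   (P : SubPartition n (suc (suc m))) where
  open SubPartition P

  private
    k : ℕ
    k = suc (suc m)

  another : (i : Fin k) → ∃ λ i′ → i′ ≢ i
  another zero    = suc zero , λ ()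
  another (suc i) = zero , λ ()

  r w : Fin k → ℚ
  r i = ratio G (part i)
  w i = ωS G (part i)

  w>0 : ∀ i → 0ℚ < w i
  w>0 i = GraphFacts.ωS-pos G (part i) (nonempty i)

  -- Each part has a nonempty complement (another part), so its cut is positive.
  r>0 : ∀ i → 0ℚ < r i
  r>0 i = divℚ-pos (GraphFacts.cut-pos G connected u∈Aᵢ (disjoint i′ i i′≢i v v∈Aᵢ′)) (w>0 i)
    where
    i′ = proj₁ (another i); i′≢i = proj₂ (another i)
    u∈Aᵢ = proj₂ (nonempty i); v = proj₁ (nonempty i′); v∈Aᵢ′ = proj₂ (nonempty i′)

  open Choice r w r>0 w>0
  open Reciprocal k

  cut≡c : ∀ i → cut G (part i) ≡ c i
  cut≡c i = sym (divℚ-* (cut G (part i)) (w i) (w>0 i))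

  W-ratio-< : ∀ j {v} → (∀ i → v ∉ part i) → ∀ Z → 0ℚ < Z → C - c j ≤ Z * w j →
              ratio G (Filling.W P j) < Z
  W-ratio-< j v∉P Z Z>0 others≤ = ratio-< Z>0 (w>0 j) (≤-trans cut-W≤ others≤) (Filling.ω-W P j G v∉P)
    where
    cut-W≤ : cut G (Filling.W P j) ≤ C - c j
    cut-W≤ = subst (cut G (Filling.W P j) ≤_) (cong₂ _-_ (Σ-cong cut≡c) (cut≡c j)) (Filling.cut-W P j G)

  objM-pos : 0ℚ < objM G k P
  objM-pos = <-≤-trans (r>0 zero) (maxℚ-ub r zero)

  objm-pos : 0ℚ < objm G k P
  objm-pos = divℚ-pos (<-≤-trans (r>0 zero) (Σ-term (<⇒≤ ∘ r>0) zero))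
                      (nq-mono-< {0} {k} (ℕ.s≤s ℕ.z≤n))

  fill-M : 1ℚ < nq (suc m) → ∀ {v} → (∀ i → v ∉ part i) →
           ∃ λ Q → IsPartition Q × objM G k Q < nq (suc m) * objM G k P
  fill-M 1<k-1 v∉P = fill , fill-isPartition , maxℚ-< Z>0 each-<
    where
    j = proj₁ (argmax w)
    open Filling P j
    M = objM G k P
    Z = nq (suc m) * M
    Z>0 : 0ℚ < Z
    Z>0 = *-pos (<-trans (positive⁻¹ 1ℚ) 1<k-1) objM-pos
    M<Z : M < Z
    M<Z = subst (_< Z) (*-identityˡ M) (*-monoˡ-<-pos M {{positive objM-pos}} 1<k-1)
    each-< : ∀ i → ratio G (filled i) < Z
    each-< i with filled-cases i
    ... | inj₁ (_ , eq) = subst (λ A → ratio G A < Z) (sym eq)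
                            (W-ratio-< j v∉P Z Z>0 (max-choice j (proj₂ (argmax w)) M (maxℚ-ub r)))
    ... | inj₂ (_ , eq) = subst (λ A → ratio G A < Z) (sym eq) (≤-<-trans (maxℚ-ub r i) M<Z)

  -- Mean-ratio: fill at the part given by the averaging choice.  The sum of ratios
  -- becomes S − rⱼ + ratio(W) < S − rⱼ + (λS + rⱼ) = 2(1 − 1/k)·S, where λ = 1 − 2/k.
  fill-m : ∀ {v} → (∀ i → v ∉ part i) →
           ∃ λ Q → IsPartition Q × objm G k Q < (two * (1ℚ - ι)) * objm G k P
  fill-m v∉P = fill , fill-isPartition , divℚ-scale-< {x = two * (1ℚ - ι)} (nq-mono-< {0} {k} k>0) T<
    where
    k>0 : 0 ℕ.< k
    k>0 = ℕ.s≤s ℕ.z≤n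
    λ′ = 1ℚ - two * ι
    λ′≥0 : 0ℚ ≤ λ′
    λ′≥0 = ≤⇒diff-nonneg (2ι≤1 k>0 (ℕ.s≤s (ℕ.s≤s ℕ.z≤n)))
    choice = mean-choice ι (ι≥0 k>0) (ι*k≡1 k>0) λ′≥0
    j = proj₁ choice
    open Filling P j
    Z>0 : 0ℚ < λ′ * S + r j
    Z>0 = <-≤-trans (r>0 j) (subst (_≤ λ′ * S + r j) (+-identityˡ (r j))
            (+-monoˡ-≤ (r j) (*-nonneg λ′≥0 (Σ-nonneg (<⇒≤ ∘ r>0)))))
    W-< : ratio G W < λ′ * S + r j
    W-< = W-ratio-< j v∉P (λ′ * S + r j) Z>0 (proj₂ choice)
    T = Σℚ (λ i → ratio G (filled i))
    exchange : T + r j ≡ S + ratio G W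
    exchange = trans (Σ-update r (λ i → ratio G (filled i)) j
                       (λ i i≢j → cong (ratio G) (updateAt-minimal i j part i≢j)))
                     (cong (λ A → S + ratio G A) (updateAt-updates j part))
    T< : T < (two * (1ℚ - ι)) * S
    T< = subst₂ _<_ (solve 2 (λ t r → t :+ r :- r := t) refl T (r j))
           (solve 3 (λ s i r → s :+ ((con 1ℚ :- (con 1ℚ :+ con 1ℚ) :* i) :* s :+ r) :- r
                             := ((con 1ℚ :+ con 1ℚ) :* (con 1ℚ :- i)) :* s) refl S ι (r j))
           (+-monoˡ-< (- r j) (subst (_< S + (λ′ * S + r j)) (sym exchange) (+-monoʳ-< S W-<)))

-- To beat a factor t > 1 by a partition it suffices to treat subpartitions that
-- leave a vertex uncovered: a partition is its own witness.
improve : ∀ {n k} (f : SubPartition n k → ℚ) (t : ℚ) → 1ℚ < t → (∀ P → 0ℚ < f P) →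
  (∀ P {v} → (∀ i → v ∉ SubPartition.part P i) → ∃ λ Q → IsPartition Q × f Q < t * f P) →
  ∀ P → ∃ λ Q → IsPartition Q × f Q < t * f P
improve f t 1<t f>0 fill-uncovered P with any? (λ v → all? (λ i → ¬? (v ∈? SubPartition.part P i)))
... | yes (v , v∉P) = fill-uncovered P v∉P
... | no  covered   = P , isPartition , fP<tfP
  where
  fP<tfP : f P < t * f P
  fP<tfP = subst (_< t * f P) (*-identityˡ (f P)) (*-monoˡ-<-pos (f P) {{positive (f>0 P)}} 1<t)
  isPartition : IsPartition P
  isPartition u = decidable-stable (any? (λ i → u ∈? SubPartition.part P i))
                    λ uncovered → covered (u , λ i u∈Aᵢ → uncovered (i , u∈Aᵢ))

SameParts : ∀ {n k} → SubPartition n k → SubPartition n k → Set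
SameParts P P′ = ∀ i → SubPartition.part P i ≡ SubPartition.part P′ i

vectors : ∀ {A : Set} → List A → ∀ n → List (Vec A n)
vectors xs zero    = List.[ [] ]
vectors xs (suc n) = cartesianProductWith _∷_ xs (vectors xs n)

∈-vectors : ∀ {A : Set} {xs : List A} → (∀ a → a ∈ₗ xs) →
            ∀ {n} (v : Vec A n) → v ∈ₗ vectors xs n
∈-vectors every []      = here refl
∈-vectors every (a ∷ v) = ∈-cartesianProductWith⁺ _∷_ (every a) (∈-vectors every v)

module Enumeration (n k : ℕ) where

  IsSubPartition : Vec (Subset n) k → Set
  IsSubPartition ps = (∀ i → ∃ λ u → u ∈ lookup ps i)
                    × (∀ i j → i ≢ j → ∀ u → u ∈ lookup ps i → u ∉ lookup ps j)

  isSubPartition? : Decidable IsSubPartition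
  isSubPartition? ps =
    all? (λ i → any? (λ u → u ∈? lookup ps i))
    ×-dec all? (λ i → all? (λ j → ¬? (i ≟ᶠ j)
                   →-dec all? (λ u → (u ∈? lookup ps i) →-dec ¬? (u ∈? lookup ps j))))

  booleans : List Bool
  booleans = true List.∷ false List.∷ List.[]

  decode : (ps : Vec (Subset n) k) → Dec (IsSubPartition ps) → List (SubPartition n k)
  decode ps (yes (nonempty , disjoint)) =
    List.[ record { part = lookup ps ; nonempty = nonempty ; disjoint = disjoint } ]
  decode ps (no _)                      = List.[]

  decode-complete : ∀ ps → IsSubPartition ps → (d : Dec (IsSubPartition ps)) →
                    ∃ λ P → P ∈ₗ decode ps d × ∀ i → SubPartition.part P i ≡ lookup ps i
  decode-complete ps _ (yes _) = _ , here refl , λ _ → refl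
  decode-complete ps h (no ¬h) = ⊥-elim (¬h h)

  decodeAll : Vec (Subset n) k → List (SubPartition n k)
  decodeAll ps = decode ps (isSubPartition? ps)

  subpartitions : List (SubPartition n k)
  subpartitions = concatMap decodeAll (vectors (vectors booleans n) k)

  subpartitions-complete : ∀ P → ∃ λ P′ → P′ ∈ₗ subpartitions × SameParts P P′
  subpartitions-complete P =
    let (P′ , P′∈ , decoded) = decode-complete ps valid (isSubPartition? ps)
    in  P′ , ∈-concatMap⁺ decodeAll (lose (∈-vectors (∈-vectors every-bool) ps) P′∈)
           , λ i → sym (trans (decoded i) (parts i))
    where
    open SubPartition P
    ps = tabulate part
    parts : ∀ i → lookup ps i ≡ part i
    parts = lookup∘tabulate part
    valid : IsSubPartition ps
    valid = (λ i → let (u , u∈) = nonempty i in u , subst (u ∈_) (sym (parts i)) u∈)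
          , λ i j i≢j u u∈ u∈′ →
              disjoint i j i≢j u (subst (u ∈_) (parts i) u∈) (subst (u ∈_) (parts j) u∈′)
    every-bool : ∀ b → b ∈ₗ booleans
    every-bool true  = here refl
    every-bool false = there (here refl)

minimum-exists : ∀ {n k} (Q : SubPartition n k → Set) → Decidable Q →
  (∀ P P′ → SameParts P P′ → Q P → Q P′) → (f : SubPartition n k → ℚ) →
  (∀ P P′ → SameParts P P′ → f P ≡ f P′) → ∃ Q → ∃ (IsMinOver Q f)
minimum-exists {n} {k} Q Q? Q-resp f f-resp (P₀ , QP₀) = f best , (best , Q-best , refl) , best-≤
  where
  open Enumeration n k
  candidates = filter Q? subpartitions
  start = subpartitions-complete P₀
  best = argmin f (proj₁ start) candidates
  Q-best : Q best
  Q-best = argmin-all f (Q-resp P₀ (proj₁ start) (proj₂ (proj₂ start)) QP₀) (all-filter Q? subpartitions)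
  best-≤ : ∀ P → Q P → f best ≤ f P
  best-≤ P QP =
    let (P′ , P′∈ , same) = subpartitions-complete P
        P′-candidate = ∈-filter⁺ Q? P′∈ (Q-resp P P′ same QP)
    in  subst (f best ≤_) (sym (f-resp P P′ same))
          (All.lookup (f[argmin]≤f[xs] {f = f} (proj₁ start) candidates) P′-candidate)

isPartition? : ∀ {n k} → Decidable (IsPartition {n} {k})
isPartition? P = all? (λ u → any? (λ i → u ∈? SubPartition.part P i))

isPartition-resp : ∀ {n k} (P P′ : SubPartition n k) →
                   SameParts P P′ → IsPartition P → IsPartition P′
isPartition-resp P P′ same covers u = let (i , u∈Aᵢ) = covers u in i , subst (u ∈_) (same i) u∈Aᵢ

maxℚ-cong : ∀ {n} {f g : Fin n → ℚ} → (∀ i → f i ≡ g i) → maxℚ f ≡ maxℚ g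
maxℚ-cong {zero}  f≗g = refl
maxℚ-cong {suc n} f≗g = cong₂ ℚ._⊔_ (f≗g zero) (maxℚ-cong (f≗g ∘ suc))

objM-resp : ∀ {n} (G : WGraph n) k (P P′ : SubPartition n k) →
            SameParts P P′ → objM G k P ≡ objM G k P′
objM-resp G k P P′ same = maxℚ-cong (cong (ratio G) ∘ same)

objm-resp : ∀ {n} (G : WGraph n) k (P P′ : SubPartition n k) →
            SameParts P P′ → objm G k P ≡ objm G k P′
objm-resp G k P P′ same = cong (λ s → divℚ s (nq k)) (Σ-cong (cong (ratio G) ∘ same))

-- The fibres of a surjection Fin n → Fin k form a k-partition; for k + 1 ≤ n
-- the map u ↦ min(u, k) : Fin n → Fin (k + 1) is such a surjection.

fibres : ∀ {n k} (lab : Fin n → Fin k) → (∀ i → ∃ λ u → lab u ≡ i) → SubPartition n k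
fibres lab onto = record
  { part     = λ i → subsetOf (λ u → lab u ≟ᶠ i)
  ; nonempty = λ i → let (u , labu≡i) = onto i in u , ∈-subsetOf⁺ (λ u → lab u ≟ᶠ i) labu≡i
  ; disjoint = λ i j i≢j u u∈i u∈j →
      i≢j (trans (sym (∈-subsetOf⁻ (λ u → lab u ≟ᶠ i) u∈i)) (∈-subsetOf⁻ (λ u → lab u ≟ᶠ j) u∈j))
  }

fibres-isPartition : ∀ {n k} lab onto → IsPartition (fibres {n} {k} lab onto)
fibres-isPartition lab onto u = lab u , ∈-subsetOf⁺ (λ v → lab v ≟ᶠ lab u) refl

clamp : ∀ {n k} → Fin n → Fin (suc k)
clamp {k = k} u = fromℕ< (ℕ.s≤s (ℕ.m⊓n≤n (toℕ u) k))

clamp-onto : ∀ {n k} → suc k ℕ.≤ n → ∀ i → ∃ λ u → clamp {n} {k} u ≡ i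
clamp-onto {k = k} k<n i = inject≤ i k<n , toℕ-injective (begin
  toℕ (clamp (inject≤ i k<n))  ≡⟨ toℕ-fromℕ< _ ⟩
  toℕ (inject≤ i k<n) ℕ.⊓ k    ≡⟨ cong (ℕ._⊓ k) (toℕ-inject≤ i k<n) ⟩
  toℕ i ℕ.⊓ k                  ≡⟨ ℕ.m≤n⇒m⊓n≡m (toℕ≤pred[n] i) ⟩
  toℕ i                        ∎)
  where open ≡-Reasoning

compare-minima : ∀ {n k} (f : SubPartition n k → ℚ) (t : ℚ) →
  (∀ P P′ → SameParts P P′ → f P ≡ f P′) → ∃ IsPartition →
  (∀ P → ∃ λ Q → IsPartition Q × f Q < t * f P) →
  ∃ λ a → ∃ λ b → IsMinOver AllSP f a × IsMinOver IsPartition f b × a ≤ b × b < t * a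
compare-minima {n} {k} f t f-resp (P₀ , P₀-partition) improve-by-t =
  a , b , a-min , b-min , subst (a ≤_) fPb≡b (proj₂ a-min Pb tt)
      , ≤-<-trans (proj₂ b-min Q Q-partition) fQ<ta
  where
  a-exists = minimum-exists AllSP (λ _ → yes tt) (λ _ _ _ _ → tt) f f-resp (P₀ , tt)
  b-exists = minimum-exists (IsPartition {n} {k}) isPartition? isPartition-resp f f-resp (P₀ , P₀-partition)
  a = proj₁ a-exists; a-min = proj₂ a-exists
  b = proj₁ b-exists; b-min = proj₂ b-exists
  Pa = proj₁ (proj₁ a-min); fPa≡a = proj₂ (proj₂ (proj₁ a-min))
  Pb = proj₁ (proj₁ b-min); fPb≡b = proj₂ (proj₂ (proj₁ b-min))
  improved = improve-by-t Pa
  Q = proj₁ improved; Q-partition = proj₁ (proj₂ improved)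
  fQ<ta : f Q < t * a
  fQ<ta = subst (λ x → f Q < t * x) fPa≡a (proj₂ (proj₂ improved))

theorem1 : ∀ {n : ℕ} (G : WGraph n) (k : ℕ) → Connected G → 3 ℕ.≤ k → k ℕ.≤ n →
  (∃ λ a → ∃ λ b → ιM-is G k a × ι~M-is G k b ×
     (a Data.Rational.≤ b) × (b < (+ (k Data.Nat.∸ 1) / 1) * a))
  × (∃ λ a → ∃ λ b → ιm-is G k a × ι~m-is G k b ×
     (a Data.Rational.≤ b) × (b < ((+ 2 / 1) * (1ℚ - divℚ 1ℚ (+ k / 1))) * a))
theorem1 {n} G (suc (suc (suc m))) connected (ℕ.s≤s (ℕ.s≤s (ℕ.s≤s ℕ.z≤n))) k≤n =
    compare-minima (objM G k) (nq (suc (suc m))) (objM-resp G k) partition₀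
      (improve (objM G k) _ 1<k-1 objM-pos (λ P → fill-M P 1<k-1))
  , compare-minima (objm G k) (two * (1ℚ - ι)) (objm-resp G k) partition₀
      (improve (objm G k) _ 1<2[1-1/k] objm-pos (λ P → fill-m P))
  where
  k = suc (suc (suc m))
  open Improvement G connected using (objM-pos; objm-pos; fill-M; fill-m)
  open Reciprocal k using (ι; 1<2[1-ι])
  partition₀ : ∃ (IsPartition {n} {k})
  partition₀ = fibres clamp (clamp-onto k≤n) , fibres-isPartition clamp (clamp-onto k≤n)
  1<k-1 : 1ℚ < nq (suc (suc m))
  1<k-1 = nq-mono-< {1} {suc (suc m)} (ℕ.s≤s (ℕ.s≤s ℕ.z≤n))
  1<2[1-1/k] : 1ℚ < two * (1ℚ - ι)
  1<2[1-1/k] = 1<2[1-ι] (ℕ.s≤s ℕ.z≤n) (ℕ.s≤s (ℕ.s≤s (ℕ.s≤s ℕ.z≤n)))
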